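{- Let $q$ be even. Suppose that $H=\mathrm{EXP}\left(\frac{2\pi i}{q}L\right)$ is a $BH(n,q)$ matrix with $\mathbb{Z}_q$-rank $r$, where $L$ is an integral $n\times n$ matrix, and suppose there are integral matrices $Q$ ($n\times r$) and $S$ ($r\times n$) with $QS\equiv L\pmod q$ such that every entry in the first row of $S$ is even. Then there exists a $BH(2n,q)$ matrix with $\mathbb{Z}_q$-rank $r$.
   Context: $\mathrm{EXP}(\cdot)$ denotes the entrywise exponential of a matrix. A $BH(n,q)$ matrix is an $n\times n$ matrix with $q$th root of unity entries satisfying $HH^\ast=nI$. The $\mathbb{Z}_q$-rank of an integral $n\times n$ matrix $L$ is the smallest positive integer $r$ such that there exist integral matrices $S$ ($n\times r$) and $T$ ($r\times n$) with $ST\equiv L \pmod q$. The $\mathbb{Z}_q$-rank of a $BH(n,q)$ matrix $H$ is the $\mathbb{Z}_q$-rank of the $\{0,\dots,q-1\}$-matrix $L$ obtained from $H$ by replacing each entry $e^{2\pi i t/q}$ by $t$. -}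

module Defs where

open import Level using (Level)
open import Data.Nat as ℕ using (ℕ; zero; suc; NonZero)
open import Data.Integer as ℤ using (ℤ; +_; -_; _-_)
open import Data.Integer.DivMod using (_%ℕ_)
open import Data.Integer.Divisibility using () renaming (_∣_ to _∣ℤ_)
open import Data.Fin using (Fin; zero; suc; _≟_)
open import Data.Product using (Σ; ∃; _×_)
open import Data.Sum using (_⊎_)
open import Relation.Nullary using (¬_; yes; no)
open import Relation.Binary.PropositionalEquality using (_≡_)
open import Algebra.Bundles using (CommutativeRing)

Mat : ℕ → ℕ → Set
Mat m k = Fin m → Fin k → ℤ

∑ℤ : ∀ {n} → (Fin n → ℤ) → ℤ
∑ℤ {zero}  f = + 0
∑ℤ {suc n} f = f zero ℤ.+ ∑ℤ (λ i → f (suc i))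

_≡_[mod_] : ℤ → ℤ → ℕ → Set
a ≡ b [mod q ] = (+ q) ∣ℤ (a - b)

FactorsMod : (q : ℕ) {n r : ℕ} → Mat n r → Mat r n → Mat n n → Set
FactorsMod q {n} {r} S T L =
  ∀ (i j : Fin n) → ∑ℤ (λ k → S i k ℤ.* T k j) ≡ L i j [mod q ]

HasFactorization : (q n r : ℕ) → Mat n n → Set
HasFactorization q n r L = Σ (Mat n r) λ S → Σ (Mat r n) λ T → FactorsMod q S T L

ZqRank : (q n : ℕ) → Mat n n → ℕ → Set
ZqRank q n L r =
  1 ℕ.≤ r × HasFactorization q n r L
    × (∀ r′ → 1 ℕ.≤ r′ → HasFactorization q n r′ L → r ℕ.≤ r′)

module _ {c ℓ : Level} (R : CommutativeRing c ℓ) where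
  open CommutativeRing R using (Carrier; _≈_; _+_; _*_; 0#; 1#)

  powR : Carrier → ℕ → Carrier
  powR x zero    = 1#
  powR x (suc k) = x * powR x k

  natR : ℕ → Carrier
  natR zero    = 0#
  natR (suc k) = 1# + natR k

  ∑R : ∀ {n} → (Fin n → Carrier) → Carrier
  ∑R {zero}  f = 0#
  ∑R {suc n} f = f zero + ∑R (λ i → f (suc i))

  IntegralDomainChar0 : Set (c Level.⊔ ℓ)
  IntegralDomainChar0 =
    (∀ x y → x * y ≈ 0# → x ≈ 0# ⊎ y ≈ 0#)
    × (∀ m → natR m ≈ 0# → m ≡ 0)

  PrimitiveRoot : (q : ℕ) → Carrier → Set ℓ
  PrimitiveRoot q ζ =
    powR ζ q ≈ 1# × (∀ k → 1 ℕ.≤ k → k ℕ.< q → ¬ (powR ζ k ≈ 1#))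

  -- EXP((2πi/q) a) realised as ζ^(a mod q)
  expζ : (q : ℕ) .{{_ : NonZero q}} → Carrier → ℤ → Carrier
  expζ q ζ a = powR ζ (a %ℕ q)

  -- H = EXP((2πi/q) L) is a BH(n,q) matrix: H H* = n I, where the
  -- conjugate of ζ^a is ζ^(-a).
  IsBH : (q : ℕ) .{{_ : NonZero q}} → Carrier → (n : ℕ) → Mat n n → Set ℓ
  IsBH q ζ n L = ∀ (i k : Fin n) →
    ∑R (λ j → expζ q ζ (L i j) * expζ q ζ (- L k j))
      ≈ (case-eq i k)
    where
      case-eq : Fin n → Fin n → Carrier
      case-eq i k with i ≟ k
      ... | yes _ = natR n
      ... | no _  = 0#

-- Write c for the first column of Q and h = q/2.  Next to H = EXP(2πi L/q) put
-- H′ = [[H, DH], [H, −DH]] with D = diag(ζ^c), whose exponent matrix is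
-- L′ = [[L, L + c1ᵀ], [L, L + c1ᵀ + h]] (h added entrywise).  The product of rows (s, a) and
-- (s′, b) of H′ is (1 + ζ^(c_a − c_b + (s − s′)h)) times that of rows a and b of H, and
-- ζ^h = −1 since in an integral domain it squares to 1 without being 1; so H′ is a BH(2n, q)
-- matrix.  From Q S ≡ L one gets Q′ S′ ≡ L′ with Q′ = [Q; Q + h e₁ᵀ] and S′ = [S, S + e₁ 1ᵀ]:
-- the only extra term, h times the first row of S, vanishes mod q = 2h because that row is
-- even.  Hence the Z_q-rank of L′ is at most r, and at least r because L is a block of L′.
module Submission where

open import Defs
open import Level using (Level)
open import Algebra.Bundles using (CommutativeRing; Monoid)
open import Data.Nat as ℕ using (ℕ; zero; suc; NonZero)
import Data.Nat.Properties as ℕₚ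
open import Data.Nat.Divisibility using (divides) renaming (_∣_ to _∣ℕ_)
open import Data.Integer as ℤ using (ℤ; +_)
import Data.Integer.Properties as ℤₚ
open import Data.Integer.DivMod using (_%ℕ_; _/ℕ_; a≡a%ℕn+[a/ℕn]*n)
open import Data.Integer.Divisibility using () renaming (_∣_ to _∣ℤ_)
open import Data.Integer.Divisibility.Signed as Signed using (divides) renaming (_∣_ to _∣ₛ_)
open import Data.Integer.Tactic.RingSolver using (solve-∀)
open import Data.Fin using (Fin; zero; suc; toℕ; _↑ˡ_; _↑ʳ_; combine; quotient; remainder; _≟_)
open import Data.Fin.Properties using (remQuot-combine; combine-remQuot)
open import Data.Product using (Σ; _×_; _,_; proj₁; proj₂)
open import Data.Sum using (_⊎_; inj₁; inj₂)
open import Data.Empty using (⊥-elim)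
open import Function using (_∘_)
open import Relation.Nullary using (¬_; yes; no)
open import Relation.Binary.PropositionalEquality as ≡ using (_≡_; _≢_)

∣a-a%ℕn : ∀ a n .{{_ : NonZero n}} → (+ n) ∣ₛ (a ℤ.- + (a %ℕ n))
∣a-a%ℕn a n = divides (a /ℕ n) (begin
    a ℤ.- + (a %ℕ n)                                  ≡⟨ ≡.cong (ℤ._- + (a %ℕ n)) (a≡a%ℕn+[a/ℕn]*n a n) ⟩
    (+ (a %ℕ n) ℤ.+ (a /ℕ n) ℤ.* + n) ℤ.- + (a %ℕ n)  ≡⟨ cancel (+ (a %ℕ n)) (a /ℕ n ℤ.* + n) ⟩
    (a /ℕ n) ℤ.* + n                                  ∎)
  where
  open ≡.≡-Reasoning
  cancel : ∀ r s → (r ℤ.+ s) ℤ.- r ≡ s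
  cancel = solve-∀

∣+m-+n∣≡m∸n : ∀ {m n} → n ℕ.≤ m → ℤ.∣ + m ℤ.- + n ∣ ≡ m ℕ.∸ n
∣+m-+n∣≡m∸n {m} {n} n≤m = ≡.cong ℤ.∣_∣ (≡.trans (ℤₚ.m-n≡m⊖n m n) (ℤₚ.⊖-≥ n≤m))

∣h*even : ∀ {q} h {x} → q ≡ h ℕ.* 2 → (+ 2) ∣ₛ x → (+ q) ∣ₛ (+ h ℤ.* x)
∣h*even {q} h {x} q≡h*2 2∣x = ≡.subst (_∣ₛ (+ h ℤ.* x)) +h*+2≡+q (Signed.*-monoʳ-∣ (+ h) 2∣x)
  where
  +h*+2≡+q : + h ℤ.* + 2 ≡ + q
  +h*+2≡+q = ≡.trans (≡.sym (ℤₚ.pos-* h 2)) (≡.cong +_ (≡.sym q≡h*2))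

module _ {a ℓ} (M : Monoid a ℓ) where
  open Monoid M
  open import Algebra.Properties.Monoid.Sum M using (sum; sum-syntax)

  sum-↑ : ∀ m n (f : Fin (m ℕ.+ n) → Carrier) →
          sum f ≈ sum (f ∘ (_↑ˡ n)) ∙ sum (f ∘ (m ↑ʳ_))
  sum-↑ zero    n f = sym (identityˡ _)
  sum-↑ (suc m) n f = trans (∙-congˡ (sum-↑ m n (f ∘ suc))) (sym (assoc _ _ _))

  sum-combine : ∀ m n (f : Fin (m ℕ.* n) → Carrier) →
                sum f ≈ ∑[ s < m ] ∑[ b < n ] f (combine s b)
  sum-combine zero    n f = refl
  sum-combine (suc m) n f =
    trans (sum-↑ n (m ℕ.* n) f) (∙-congˡ (sum-combine m n (λ i → f (n ↑ʳ i))))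

module _ {m n : ℕ} where

  quotient-combine : ∀ (s : Fin m) (b : Fin n) → quotient {m} n (combine s b) ≡ s
  quotient-combine s b = ≡.cong proj₁ (remQuot-combine s b)

  remainder-combine : ∀ (s : Fin m) (b : Fin n) → remainder {m} n (combine s b) ≡ b
  remainder-combine s b = ≡.cong proj₂ (remQuot-combine s b)

  quotient-remainder-injective : ∀ {i k : Fin (m ℕ.* n)} →
    quotient {m} n i ≡ quotient {m} n k → remainder {m} n i ≡ remainder {m} n k → i ≡ k
  quotient-remainder-injective {i} {k} ≡quotient ≡remainder =
    ≡.trans (≡.sym (combine-remQuot {m} n i))
      (≡.trans (≡.cong₂ combine ≡quotient ≡remainder) (combine-remQuot {m} n k))

-- An index i of the doubled matrix is combine s a: block s ∈ {0, 1} and position a in the block.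

bit : Fin 2 → ℤ
bit s = + toℕ s

twist : ∀ {n} → ℕ → (Fin n → ℤ) → Fin (2 ℕ.* n) → ℤ
twist {n} h c i = c (remainder {2} n i) ℤ.+ bit (quotient {2} n i) ℤ.* + h

doubled : ∀ {n} → ℕ → (Fin n → ℤ) → Mat n n → Mat (2 ℕ.* n) (2 ℕ.* n)
doubled {n} h c L i j =
  L (remainder {2} n i) (remainder {2} n j) ℤ.+ bit (quotient {2} n j) ℤ.* twist h c i

doubled-combine : ∀ {n} h c (L : Mat n n) i t b →
  doubled h c L i (combine t b) ≡ L (remainder {2} n i) b ℤ.+ bit t ℤ.* twist h c i
doubled-combine {n} h c L i t b =
  ≡.cong₂ (λ t′ b′ → L (remainder {2} n i) b′ ℤ.+ bit t′ ℤ.* twist h c i)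
    (quotient-combine t b) (remainder-combine t b)

doubled-top : ∀ {n} h c (L : Mat n n) a b →
  doubled h c L (combine {2} zero a) (combine {2} zero b) ≡ L a b
doubled-top h c L a b =
  ≡.trans (doubled-combine h c L (combine {2} zero a) zero b)
    (≡.trans (ℤₚ.+-identityʳ _) (≡.cong (λ a′ → L a′ b) (remainder-combine {2} zero a)))

twist-difference : ∀ {n} h c {i k : Fin (2 ℕ.* n)} → remainder {2} n i ≡ remainder {2} n k →
  twist h c i ℤ.- twist h c k ℤ.- + h ≡ + h ℤ.* (bit (quotient {2} n i) ℤ.- bit (quotient {2} n k) ℤ.- + 1)
twist-difference {n} h c {i} {k} ≡remainder =
  ≡.trans (≡.cong (λ a → twist h c i ℤ.- (c a ℤ.+ bit s′ ℤ.* + h) ℤ.- + h) (≡.sym ≡remainder))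
    (cancel (c (remainder {2} n i)) (bit s) (bit s′) (+ h))
  where
  s = quotient {2} n i
  s′ = quotient {2} n k
  cancel : ∀ x u v y → (x ℤ.+ u ℤ.* y) ℤ.- (x ℤ.+ v ℤ.* y) ℤ.- y ≡ y ℤ.* (u ℤ.- v ℤ.- + 1)
  cancel = solve-∀

bit-bit-1-even : ∀ {s s′} → s ≢ s′ → (+ 2) ∣ₛ (bit s ℤ.- bit s′ ℤ.- + 1)
bit-bit-1-even {zero}     {zero}     s≢s′ = ⊥-elim (s≢s′ ≡.refl)
bit-bit-1-even {zero}     {suc zero} _    = divides (ℤ.- + 1) ≡.refl
bit-bit-1-even {suc zero} {zero}     _    = divides (+ 0) ≡.refl
bit-bit-1-even {suc zero} {suc zero} s≢s′ = ⊥-elim (s≢s′ ≡.refl)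

module _ {n r : ℕ} (h : ℕ) (Q : Mat n (suc r)) (S : Mat (suc r) n) where

  private
    c : Fin n → ℤ
    c a = Q a zero

  doubledˡ : Mat (2 ℕ.* n) (suc r)
  doubledˡ i zero    = twist h c i
  doubledˡ i (suc k) = Q (remainder {2} n i) (suc k)

  doubledʳ : Mat (suc r) (2 ℕ.* n)
  doubledʳ zero    j = S zero (remainder {2} n j) ℤ.+ bit (quotient {2} n j)
  doubledʳ (suc k) j = S (suc k) (remainder {2} n j)

  factorsMod-doubled : ∀ {q} {L : Mat n n} → q ≡ h ℕ.* 2 → FactorsMod q Q S L →
                       (∀ b → (+ 2) ∣ℤ S zero b) → FactorsMod q doubledˡ doubledʳ (doubled h c L)
  factorsMod-doubled {q} {L} q≡h*2 QS≡L S₀-even i j =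
    Signed.∣⇒∣ᵤ (≡.subst ((+ q) ∣ₛ_) (regroup (c a) s (+ h) (S zero b) t rest (L a b))
      (Signed.∣m∣n⇒∣m+n q∣QS-L (Signed.∣n⇒∣m*n s (∣h*even h q≡h*2 2∣S₀))))
    where
    a = remainder {2} n i
    b = remainder {2} n j
    s = bit (quotient {2} n i)
    t = bit (quotient {2} n j)
    rest = ∑ℤ (λ k → Q a (suc k) ℤ.* S (suc k) b)
    q∣QS-L : (+ q) ∣ₛ (∑ℤ (λ k → Q a k ℤ.* S k b) ℤ.- L a b)
    q∣QS-L = Signed.∣ᵤ⇒∣ (QS≡L a b)
    2∣S₀ : (+ 2) ∣ₛ S zero b
    2∣S₀ = Signed.∣ᵤ⇒∣ (S₀-even b)
    regroup : ∀ x s y z t u w →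
      ((x ℤ.* z ℤ.+ u) ℤ.- w) ℤ.+ s ℤ.* (y ℤ.* z)
        ≡ ((x ℤ.+ s ℤ.* y) ℤ.* (z ℤ.+ t) ℤ.+ u) ℤ.- (w ℤ.+ t ℤ.* (x ℤ.+ s ℤ.* y))
    regroup = solve-∀

module _ {q N n : ℕ} {M : Mat N N} {L : Mat n n}
         (f : Fin n → Fin N) (M∘f≡L : ∀ a b → M (f a) (f b) ≡ L a b) where

  hasFactorization-restrict : ∀ {r} → HasFactorization q N r M → HasFactorization q n r L
  hasFactorization-restrict (Q , S , QS≡M) =
    (λ a → Q (f a)) , (λ k b → S k (f b)) ,
    λ a b → ≡.subst (λ x → ∑ℤ (λ k → Q (f a) k ℤ.* S k (f b)) ≡ x [mod q ]) (M∘f≡L a b) (QS≡M (f a) (f b))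

  zqRank-extend : ∀ {r} → ZqRank q n L r → HasFactorization q N r M → ZqRank q N M r
  zqRank-extend (1≤r , _ , minimal) factorization =
    1≤r , factorization , λ r′ 1≤r′ → minimal r′ 1≤r′ ∘ hasFactorization-restrict

module _ {c ℓ} (R : CommutativeRing c ℓ) where
  open CommutativeRing R hiding (zero)
  open import Algebra.Properties.Group +-group using (inverseˡ-unique; x∙y⁻¹≈ε⇒x≈y)
  open import Algebra.Properties.Ring ring using (-‿distribʳ-*)
  open import Relation.Binary.Reasoning.Setoid setoid

  square≈1⇒≈-1 : (∀ x y → x * y ≈ 0# → x ≈ 0# ⊎ y ≈ 0#) →
                 ∀ {x} → x * x ≈ 1# → ¬ x ≈ 1# → x ≈ - 1#
  square≈1⇒≈-1 noZeroDivisors {x} x²≈1 x≉1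
    with noZeroDivisors (x + 1#) (x - 1#) [x+1][x-1]≈0
    where
    [x+1][x-1]≈0 : (x + 1#) * (x - 1#) ≈ 0#
    [x+1][x-1]≈0 = begin
      (x + 1#) * (x - 1#)                   ≈⟨ distribˡ (x + 1#) x (- 1#) ⟩
      (x + 1#) * x + (x + 1#) * - 1#        ≈⟨ +-cong (distribʳ x x 1#) (sym (-‿distribʳ-* (x + 1#) 1#)) ⟩
      (x * x + 1# * x) + - ((x + 1#) * 1#)
        ≈⟨ +-cong (+-cong x²≈1 (*-identityˡ x)) (-‿cong (*-identityʳ (x + 1#))) ⟩
      (1# + x) + - (x + 1#)                 ≈⟨ +-congʳ (+-comm 1# x) ⟩
      (x + 1#) + - (x + 1#)                 ≈⟨ -‿inverseʳ (x + 1#) ⟩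
      0#                                    ∎
  ... | inj₁ x+1≈0 = inverseˡ-unique x 1# x+1≈0
  ... | inj₂ x-1≈0 = ⊥-elim (x≉1 (x∙y⁻¹≈ε⇒x≈y x 1# x-1≈0))

  natR-+ : ∀ m k → natR R (m ℕ.+ k) ≈ natR R m + natR R k
  natR-+ zero    k = sym (+-identityˡ _)
  natR-+ (suc m) k = trans (+-congˡ (natR-+ m k)) (sym (+-assoc 1# _ _))

module RootOfUnity {c ℓ} (R : CommutativeRing c ℓ) (q : ℕ) .{{_ : NonZero q}}
                   (ζ : CommutativeRing.Carrier R)
                   (ζ^q≈1 : CommutativeRing._≈_ R (powR R ζ q) (CommutativeRing.1# R)) where
  open CommutativeRing R hiding (zero)
  open import Relation.Binary.Reasoning.Setoid setoid
  open import Algebra.Properties.Semiring.Sum semiring using (sum; sum-syntax; sum-cong-≋; *-distribˡ-sum)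

  ζ^_ : ℕ → Carrier
  ζ^_ = powR R ζ

  EXP : ℤ → Carrier
  EXP = expζ R q ζ

  ζ^-+ : ∀ m k → ζ^ (m ℕ.+ k) ≈ ζ^ m * ζ^ k
  ζ^-+ zero    k = sym (*-identityˡ _)
  ζ^-+ (suc m) k = trans (*-congˡ (ζ^-+ m k)) (sym (*-assoc ζ _ _))

  ζ^-*q : ∀ t → ζ^ (t ℕ.* q) ≈ 1#
  ζ^-*q zero    = refl
  ζ^-*q (suc t) = begin
    ζ^ (q ℕ.+ t ℕ.* q)     ≈⟨ ζ^-+ q (t ℕ.* q) ⟩
    ζ^ q * ζ^ (t ℕ.* q)    ≈⟨ *-cong ζ^q≈1 (ζ^-*q t) ⟩
    1# * 1#                ≈⟨ *-identityˡ 1# ⟩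
    1#                     ∎

  ζ^-cong-≤ : ∀ {x y} → y ℕ.≤ x → q ∣ℕ (x ℕ.∸ y) → ζ^ x ≈ ζ^ y
  ζ^-cong-≤ {x} {y} y≤x (divides t x∸y≡t*q) = begin
    ζ^ x                   ≡⟨ ≡.cong ζ^_ x≡y+t*q ⟩
    ζ^ (y ℕ.+ t ℕ.* q)     ≈⟨ ζ^-+ y (t ℕ.* q) ⟩
    ζ^ y * ζ^ (t ℕ.* q)    ≈⟨ *-congˡ (ζ^-*q t) ⟩
    ζ^ y * 1#              ≈⟨ *-identityʳ (ζ^ y) ⟩
    ζ^ y                   ∎
    where
    x≡y+t*q : x ≡ y ℕ.+ t ℕ.* q
    x≡y+t*q = ≡.trans (≡.sym (ℕₚ.m+[n∸m]≡n y≤x)) (≡.cong (y ℕ.+_) x∸y≡t*q)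

  ζ^-cong : ∀ x y → (+ q) ∣ₛ (+ x ℤ.- + y) → ζ^ x ≈ ζ^ y
  ζ^-cong x y q∣x-y with ℕₚ.≤-total y x
  ... | inj₁ y≤x = ζ^-cong-≤ y≤x (≡.subst (q ∣ℕ_) (∣+m-+n∣≡m∸n y≤x) (Signed.∣⇒∣ᵤ q∣x-y))
  ... | inj₂ x≤y = sym (ζ^-cong-≤ x≤y (≡.subst (q ∣ℕ_) ∣x-y∣≡y∸x (Signed.∣⇒∣ᵤ q∣x-y)))
    where
    ∣x-y∣≡y∸x : ℤ.∣ + x ℤ.- + y ∣ ≡ y ℕ.∸ x
    ∣x-y∣≡y∸x = ≡.trans (ℤₚ.∣i-j∣≡∣j-i∣ (+ x) (+ y)) (∣+m-+n∣≡m∸n x≤y)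

  EXP-nat : ∀ m → EXP (+ m) ≈ ζ^ m
  EXP-nat m = sym (ζ^-cong m ((+ m) %ℕ q) (∣a-a%ℕn (+ m) q))

  EXP-cong : ∀ a b → (+ q) ∣ₛ (a ℤ.- b) → EXP a ≈ EXP b
  EXP-cong a b q∣a-b = ζ^-cong (a %ℕ q) (b %ℕ q)
      (≡.subst ((+ q) ∣ₛ_) (telescope a b (+ (a %ℕ q)) (+ (b %ℕ q)))
        (Signed.∣m∣n⇒∣m+n (Signed.∣m∣n⇒∣m-n q∣a-b (∣a-a%ℕn a q)) (∣a-a%ℕn b q)))
    where
    telescope : ∀ a b a′ b′ → ((a ℤ.- b) ℤ.- (a ℤ.- a′)) ℤ.+ (b ℤ.- b′) ≡ a′ ℤ.- b′
    telescope = solve-∀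

  EXP-+ : ∀ a b → EXP (a ℤ.+ b) ≈ EXP a * EXP b
  EXP-+ a b = begin
    EXP (a ℤ.+ b)          ≈⟨ EXP-cong (a ℤ.+ b) (+ (a′ ℕ.+ b′)) q∣a+b-[a′+b′] ⟩
    EXP (+ (a′ ℕ.+ b′))    ≈⟨ EXP-nat (a′ ℕ.+ b′) ⟩
    ζ^ (a′ ℕ.+ b′)         ≈⟨ ζ^-+ a′ b′ ⟩
    EXP a * EXP b          ∎
    where
    a′ = a %ℕ q
    b′ = b %ℕ q
    interchange : ∀ a b a′ b′ → (a ℤ.- a′) ℤ.+ (b ℤ.- b′) ≡ (a ℤ.+ b) ℤ.- (a′ ℤ.+ b′)
    interchange = solve-∀
    q∣a+b-[a′+b′] : (+ q) ∣ₛ ((a ℤ.+ b) ℤ.- (+ a′ ℤ.+ + b′))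
    q∣a+b-[a′+b′] = ≡.subst ((+ q) ∣ₛ_) (interchange a b (+ a′) (+ b′))
                      (Signed.∣m∣n⇒∣m+n (∣a-a%ℕn a q) (∣a-a%ℕn b q))

  EXP-half≈-1 : (∀ x y → x * y ≈ 0# → x ≈ 0# ⊎ y ≈ 0#) → PrimitiveRoot R q ζ →
                ∀ h → q ≡ h ℕ.* 2 → EXP (+ h) ≈ - 1#
  EXP-half≈-1 noZeroDivisors (_ , ζ^k≉1) h q≡h*2 = square≈1⇒≈-1 R noZeroDivisors EXP-h²≈1 EXP-h≉1
    where
    h+h≡q : h ℕ.+ h ≡ q
    h+h≡q = ≡.sym (≡.trans q≡h*2 (≡.trans (ℕₚ.*-comm h 2) (≡.cong (h ℕ.+_) (ℕₚ.+-identityʳ h))))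
    0<h : 0 ℕ.< h
    0<h = ℕₚ.n≢0⇒n>0 λ h≡0 →
      ℕₚ.<-irrefl ≡.refl (≡.subst (λ x → 0 ℕ.< x ℕ.* 2) h≡0 (≡.subst (0 ℕ.<_) q≡h*2 (ℕ.>-nonZero⁻¹ q)))
    EXP-h²≈1 : EXP (+ h) * EXP (+ h) ≈ 1#
    EXP-h²≈1 = begin
      EXP (+ h) * EXP (+ h)   ≈⟨ sym (EXP-+ (+ h) (+ h)) ⟩
      EXP (+ (h ℕ.+ h))       ≈⟨ EXP-nat (h ℕ.+ h) ⟩
      ζ^ (h ℕ.+ h)            ≡⟨ ≡.cong ζ^_ h+h≡q ⟩
      ζ^ q                    ≈⟨ ζ^q≈1 ⟩
      1#                      ∎
    EXP-h≉1 : ¬ EXP (+ h) ≈ 1#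
    EXP-h≉1 EXP-h≈1 =
      ζ^k≉1 h 0<h (≡.subst (h ℕ.<_) h+h≡q (ℕₚ.m<m+n h 0<h)) (trans (sym (EXP-nat h)) EXP-h≈1)

  ∑R≡sum : ∀ {n} (f : Fin n → Carrier) → ∑R R f ≡ sum f
  ∑R≡sum {zero}  f = ≡.refl
  ∑R≡sum {suc n} f = ≡.cong (_+_ (f zero)) (∑R≡sum (f ∘ suc))

  gram : ∀ {N} → Mat N N → Fin N → Fin N → Carrier
  gram M i k = sum (λ j → EXP (M i j ℤ.- M k j))

  module _ {N} (M : Mat N N) where

    ∑R-rowProduct≈gram : ∀ i k → ∑R R (λ j → EXP (M i j) * EXP (ℤ.- M k j)) ≈ gram M i k
    ∑R-rowProduct≈gram i k = trans (reflexive (∑R≡sum (λ j → EXP (M i j) * EXP (ℤ.- M k j))))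
                                   (sum-cong-≋ (λ j → sym (EXP-+ (M i j) (ℤ.- M k j))))

    isBH-intro : (∀ i → gram M i i ≈ natR R N) → (∀ i k → i ≢ k → gram M i k ≈ 0#) → IsBH R q ζ N M
    isBH-intro diag offDiag i k with i ≟ k
    ... | yes ≡.refl = trans (∑R-rowProduct≈gram i i) (diag i)
    ... | no i≢k     = trans (∑R-rowProduct≈gram i k) (offDiag i k i≢k)

    isBH⇒gram-diag : IsBH R q ζ N M → ∀ i → gram M i i ≈ natR R N
    isBH⇒gram-diag isBH i with i ≟ i | isBH i i
    ... | yes _  | rowProduct≈N = trans (sym (∑R-rowProduct≈gram i i)) rowProduct≈N
    ... | no i≢i | _            = ⊥-elim (i≢i ≡.refl)

    isBH⇒gram-offDiag : IsBH R q ζ N M → ∀ i k → i ≢ k → gram M i k ≈ 0#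
    isBH⇒gram-offDiag isBH i k i≢k with i ≟ k | isBH i k
    ... | yes i≡k | _            = ⊥-elim (i≢k i≡k)
    ... | no _    | rowProduct≈0 = trans (sym (∑R-rowProduct≈gram i k)) rowProduct≈0

  module _ {n} (h : ℕ) (c : Fin n → ℤ) (L : Mat n n) where
    private
      D = doubled h c L
      half : Fin (2 ℕ.* n) → Fin n
      half = remainder {2} n

    gram-doubled : ∀ i k →
      gram D i k ≈ (1# + EXP (twist h c i ℤ.- twist h c k)) * gram L (half i) (half k)
    gram-doubled i k = begin
      gram D i k
        ≈⟨ sum-combine +-monoid 2 n (λ j → EXP (D i j ℤ.- D k j)) ⟩
      ∑[ t < 2 ] ∑[ b < n ] EXP (D i (combine t b) ℤ.- D k (combine t b))
        ≈⟨ sum-cong-≋ (λ t → sum-cong-≋ (λ b → column t b)) ⟩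
      ∑[ t < 2 ] ∑[ b < n ] (EXP (bit t ℤ.* δ) * row b)
        ≈⟨ sum-cong-≋ (λ t → sym (*-distribˡ-sum (EXP (bit t ℤ.* δ)) row)) ⟩
      ∑[ t < 2 ] (EXP (bit t ℤ.* δ) * g)
        -- the t = 0 summand is EXP (+ 0) * g on the nose, the t = 1 summand EXP (+ 1 ℤ.* δ) * g
        ≈⟨ +-cong (*-congʳ (EXP-nat 0)) (+-congʳ (*-congʳ (reflexive (≡.cong EXP (ℤₚ.*-identityˡ δ))))) ⟩
      1# * g + (EXP δ * g + 0#)
        ≈⟨ +-congˡ (+-identityʳ (EXP δ * g)) ⟩
      1# * g + EXP δ * g
        ≈⟨ sym (distribʳ g 1# (EXP δ)) ⟩
      (1# + EXP δ) * g ∎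
      where
      δ = twist h c i ℤ.- twist h c k
      g = gram L (half i) (half k)
      row : Fin n → Carrier
      row b = EXP (L (half i) b ℤ.- L (half k) b)
      column : ∀ t b → EXP (D i (combine t b) ℤ.- D k (combine t b)) ≈ EXP (bit t ℤ.* δ) * row b
      column t b = begin
        EXP (D i (combine t b) ℤ.- D k (combine t b))
          ≡⟨ ≡.cong₂ (λ x y → EXP (x ℤ.- y)) (doubled-combine h c L i t b) (doubled-combine h c L k t b) ⟩
        EXP ((L (half i) b ℤ.+ bit t ℤ.* twist h c i) ℤ.- (L (half k) b ℤ.+ bit t ℤ.* twist h c k))
          ≡⟨ ≡.cong EXP (regroup (L (half i) b) (L (half k) b) (bit t) (twist h c i) (twist h c k)) ⟩
        EXP (bit t ℤ.* δ ℤ.+ (L (half i) b ℤ.- L (half k) b))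
          ≈⟨ EXP-+ (bit t ℤ.* δ) _ ⟩
        EXP (bit t ℤ.* δ) * row b ∎
        where
        regroup : ∀ x y u α β → (x ℤ.+ u ℤ.* α) ℤ.- (y ℤ.+ u ℤ.* β) ≡ u ℤ.* (α ℤ.- β) ℤ.+ (x ℤ.- y)
        regroup = solve-∀

    isBH-doubled : q ≡ h ℕ.* 2 → EXP (+ h) ≈ - 1# → IsBH R q ζ n L → IsBH R q ζ (2 ℕ.* n) D
    isBH-doubled q≡h*2 EXP-h≈-1 isBH = isBH-intro D diag offDiag
      where
      diag : ∀ i → gram D i i ≈ natR R (2 ℕ.* n)
      diag i = begin
        gram D i i                                       ≈⟨ gram-doubled i i ⟩
        (1# + EXP (twist h c i ℤ.- twist h c i)) * gram L (half i) (half i)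
          ≈⟨ *-cong (+-congˡ EXP-0) (isBH⇒gram-diag L isBH (half i)) ⟩
        (1# + 1#) * natR R n                             ≈⟨ distribʳ (natR R n) 1# 1# ⟩
        1# * natR R n + 1# * natR R n                    ≈⟨ +-cong (*-identityˡ _) (*-identityˡ _) ⟩
        natR R n + natR R n
          ≡⟨ ≡.cong (λ n′ → natR R n + natR R n′) (≡.sym (ℕₚ.+-identityʳ n)) ⟩
        natR R n + natR R (n ℕ.+ 0)                      ≈⟨ sym (natR-+ R n (n ℕ.+ 0)) ⟩
        natR R (2 ℕ.* n)                                 ∎
        where
        EXP-0 : EXP (twist h c i ℤ.- twist h c i) ≈ 1#
        EXP-0 = trans (reflexive (≡.cong EXP (ℤₚ.+-inverseʳ (twist h c i)))) (EXP-nat 0)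

      offDiag : ∀ i k → i ≢ k → gram D i k ≈ 0#
      offDiag i k i≢k with half i ≟ half k
      ... | no half-i≢half-k = trans (gram-doubled i k)
            (trans (*-congˡ (isBH⇒gram-offDiag L isBH (half i) (half k) half-i≢half-k)) (zeroʳ _))
      ... | yes half-i≡half-k = trans (gram-doubled i k)
            (trans (*-congʳ (trans (+-congˡ EXP-twists) (-‿inverseʳ 1#))) (zeroˡ _))
        where
        s≢s′ : quotient {2} n i ≢ quotient {2} n k
        s≢s′ s≡s′ = i≢k (quotient-remainder-injective s≡s′ half-i≡half-k)
        q∣twists-h : (+ q) ∣ₛ (twist h c i ℤ.- twist h c k ℤ.- + h)
        q∣twists-h = ≡.subst ((+ q) ∣ₛ_) (≡.sym (twist-difference h c half-i≡half-k))
                       (∣h*even h q≡h*2 (bit-bit-1-even s≢s′))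
        EXP-twists : EXP (twist h c i ℤ.- twist h c k) ≈ - 1#
        EXP-twists = trans (EXP-cong (twist h c i ℤ.- twist h c k) (+ h) q∣twists-h) EXP-h≈-1

open import Data.Nat using (_*_)
open import Data.Nat.Divisibility using (_∣_)

corollary1p4p59 : ∀ {c ℓ : Level} (R : CommutativeRing c ℓ) → IntegralDomainChar0 R →
    (q : ℕ) .{{_ : NonZero q}} → 2 ∣ q →
    (ζ : CommutativeRing.Carrier R) → PrimitiveRoot R q ζ →
    (n r : ℕ) (L : Mat n n) →
    IsBH R q ζ n L → ZqRank q n L r →
    (Q : Mat n r) (S : Mat r n) → FactorsMod q Q S L →
    (∀ (a : Fin r) → toℕ a ≡ 0 → ∀ (j : Fin n) → (+ 2) ∣ℤ S a j) →
    Σ (Mat (2 * n) (2 * n)) λ L′ → IsBH R q ζ (2 * n) L′ × ZqRank q (2 * n) L′ r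
corollary1p4p59 R _ q _ ζ _ n zero L _ (() , _) Q S _ _
corollary1p4p59 R (noZeroDivisors , _) q (divides h q≡h*2) ζ ζ-primitive n (suc r) L isBH rank Q S QS≡L S-even =
  doubled h c L ,
  isBH-doubled h c L q≡h*2 (EXP-half≈-1 noZeroDivisors ζ-primitive h q≡h*2) isBH ,
  zqRank-extend (combine {2} zero) (doubled-top h c L) rank
    (doubledˡ h Q S , doubledʳ h Q S , factorsMod-doubled h Q S q≡h*2 QS≡L (S-even zero ≡.refl))
  where
  open RootOfUnity R q ζ (proj₁ ζ-primitive)
  c : Fin n → ℤ
  c a = Q a zero
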